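{- Let $G$ be a connected split graph, with vertex set partitioned into a clique $X$ and an independent set $Y$, which is not a tree. Then $\sigma_T(G)=2$ if and only if either (i) $d_G(y)=1$ for all $y\in Y$, or (ii) there exists $x\in X$ with $x\in\bigcap_{y\in Y,\ d_G(y)\ge 2} N_G(y)$, i.e. $x$ is adjacent to every vertex $y\in Y$ with $d_G(y)\ge 2$.
   Context: All graphs are finite and simple. A split graph is a graph whose vertex set can be partitioned into a clique $X$ and an independent set $Y$. A tree $t$-spanner of a connected graph $G$ is a spanning tree $T$ of $G$ such that $d_T(u,v)\le t$ for every edge $uv$ of $G$; the stretch index $\sigma_T(G)$ is the smallest $t$ for which $G$ has a tree $t$-spanner. -}

module Defs where

open import Data.Nat using (ℕ; zero; suc; _≤_)
open import Data.Bool using (Bool; true; false)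
open import Data.Fin using (Fin; zero; suc; inject₁; fromℕ)
open import Data.List using (length; filterᵇ; allFin)
open import Data.Product using (Σ; _×_; ∃; ∃-syntax)
open import Data.Empty using (⊥)
open import Relation.Nullary using (¬_)
open import Relation.Binary.PropositionalEquality using (_≡_)
open import Function.Definitions using (Injective)

record Graph (n : ℕ) : Set where
  field
    adj    : Fin n → Fin n → Bool
    sym    : ∀ u v → adj u v ≡ adj v u
    irrefl : ∀ v → adj v v ≡ false
open Graph public

Adj : ∀ {n} → Graph n → Fin n → Fin n → Set
Adj G u v = adj G u v ≡ true

data Walk {n : ℕ} (G : Graph n) : Fin n → Fin n → ℕ → Set where
  here : ∀ {v} → Walk G v v 0
  step : ∀ {u w v k} → Adj G u w → Walk G w v k → Walk G u v (suc k)

DistLe : ∀ {n} → Graph n → Fin n → Fin n → ℕ → Set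
DistLe G u v t = ∃[ k ] (Walk G u v k × k ≤ t)

Connected : ∀ {n} → Graph n → Set
Connected G = ∀ u v → ∃[ k ] Walk G u v k

-- A cycle: distinct vertices c 0, …, c (k+2) (at least 3 of them),
-- consecutive ones adjacent and the last adjacent to the first.
HasCycle : ∀ {n} → Graph n → Set
HasCycle {n} G =
  ∃[ k ] Σ (Fin (suc (suc (suc k))) → Fin n) λ c →
    Injective _≡_ _≡_ c
    × (∀ (i : Fin (suc (suc k))) → Adj G (c (inject₁ i)) (c (suc i)))
    × Adj G (c (fromℕ (suc (suc k)))) (c zero)

IsTree : ∀ {n} → Graph n → Set
IsTree G = Connected G × ¬ HasCycle G

Subgraph : ∀ {n} → Graph n → Graph n → Set
Subgraph T G = ∀ u v → Adj T u v → Adj G u v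

IsTreeSpanner : ∀ {n} → Graph n → Graph n → ℕ → Set
IsTreeSpanner G T t =
  Subgraph T G × IsTree T × (∀ u v → Adj G u v → DistLe T u v t)

HasTreeSpanner : ∀ {n} → Graph n → ℕ → Set
HasTreeSpanner G t = ∃[ T ] IsTreeSpanner G T t

StretchIndex : ∀ {n} → Graph n → ℕ → Set
StretchIndex G t = HasTreeSpanner G t × (∀ s → HasTreeSpanner G s → t ≤ s)

degree : ∀ {n} → Graph n → Fin n → ℕ
degree {n} G v = length (filterᵇ (adj G v) (allFin n))

-- Split partition: inX v ≡ true means v ∈ X, inX v ≡ false means v ∈ Y;
-- X is a clique and Y is an independent set.
IsSplitPartition : ∀ {n} → Graph n → (Fin n → Bool) → Set
IsSplitPartition G inX =
  (∀ u v → inX u ≡ true → inX v ≡ true → ¬ u ≡ v → Adj G u v)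
  × (∀ u v → inX u ≡ false → inX v ≡ false → ¬ Adj G u v)

-- In a tree 2-spanner T of G the clique X induces a star: if x₁, x₂ ∈ X are joined in T
-- through m, a vertex x₃ ∈ X that is neither m nor a T-neighbour of m would close a cycle
-- of length at most 6 with x₁ – m – x₂, so all of X lies within T-distance 1 of a
-- centre c. A vertex y ∈ Y with two neighbours a, b but not adjacent to c must reach a
-- and b by T-edges (otherwise a triangle through c appears), and then y a c b is a
-- 4-cycle. Hence c, or when c ∈ Y any vertex of X (all are T-neighbours of c), is
-- adjacent to every y ∈ Y of degree at least 2; condition (i) is the case where no such
-- y exists. Conversely, for such an x, hanging X and the neighbours of x from x and every
-- other vertex of Y, whose degree is then 1, from its neighbour gives a tree 2-spanner,
-- and stretch 1 is impossible because G is not a tree.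

{-# OPTIONS --safe #-}
module Submission where

open import Defs
open import Data.Nat using (ℕ; zero; suc; _+_; _≤_; _<_; z≤n; s≤s)
open import Data.Nat.Properties using (≤-refl; ≤-trans; +-mono-≤; ≰⇒>; <⇒≤; <⇒≱; <-irrefl)
import Data.Nat.Properties as ℕ
open import Data.Bool using (Bool; true; false)
import Data.Bool as Bool
open import Data.Fin using (Fin; zero; suc; inject₁; fromℕ; _≟_)
open import Data.Fin.Properties using (suc-injective; any?)
open import Data.List using (List; []; _∷_; length; filterᵇ; allFin)
open import Data.List.Membership.Propositional using (_∈_)
open import Data.List.Membership.Propositional.Properties using (∈-allFin; ∈-filter⁺; ∈-filter⁻)
open import Data.List.Relation.Unary.Any using (here; there)
open import Data.List.Relation.Unary.All using (_∷_)
open import Data.List.Relation.Unary.AllPairs using (_∷_)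
import Data.List.Relation.Unary.Unique.Propositional as List
open import Data.List.Relation.Unary.Unique.Propositional.Properties using (allFin⁺; filter⁺)
open import Data.Bool.Properties using (T-≡; ∨-comm; ¬-not)
open import Function.Bundles using (Equivalence; _⇔_; mk⇔)
open import Data.Vec using (Vec; []; _∷_; lookup)
open import Data.Vec.Relation.Unary.Linked using (Linked; []; [-]; _∷_)
open import Data.Vec.Relation.Unary.AllPairs using ([]; _∷_)
open import Data.Vec.Relation.Unary.All using ([]; _∷_)
open import Data.Vec.Relation.Unary.Unique.Propositional using (Unique)
open import Data.Vec.Relation.Unary.Unique.Propositional.Properties using (lookup-injective)
open import Data.Product using (_×_; _,_; proj₁; proj₂; ∃; ∃-syntax)
open import Data.Sum using (_⊎_; inj₁; inj₂; [_,_]; [_,_]′)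
open import Data.Empty using (⊥; ⊥-elim)
open import Relation.Nullary using (¬_; Dec; yes; no; does; ¬?)
open import Relation.Nullary.Decidable
  using (toSum; T?; decidable-stable; _⊎-dec_; _×-dec_; dec-true; dec-false)
open import Relation.Unary using (Decidable)
open import Relation.Binary.PropositionalEquality using (_≡_; _≢_; refl; trans; cong; subst; ≢-sym)
import Relation.Binary.PropositionalEquality as ≡
open import Function using (_∘_)

-- Adjacency, walks and distances

module _ {n} (G : Graph n) where

  Adj-sym : ∀ {u v} → Adj G u v → Adj G v u
  Adj-sym {u} {v} = trans (Graph.sym G v u)

  Adj⇒≢ : ∀ {u v} → Adj G u v → u ≢ v
  Adj⇒≢ {u} uv refl with () ← trans (≡.sym uv) (Graph.irrefl G u)

  Adj? : ∀ u v → Dec (Adj G u v)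
  Adj? u v = adj G u v Bool.≟ true

module _ {n} {G : Graph n} where

  Walk-snoc : ∀ {u v w k} → Walk G u v k → Adj G v w → Walk G u w (suc k)
  Walk-snoc here         vw = step vw here
  Walk-snoc (step uw p)  vw = step uw (Walk-snoc p vw)

  Walk-reverse : ∀ {u v k} → Walk G u v k → Walk G v u k
  Walk-reverse here        = here
  Walk-reverse (step uw p) = Walk-snoc (Walk-reverse p) (Adj-sym G uw)

  _++ʷ_ : ∀ {u v w k l} → Walk G u v k → Walk G v w l → Walk G u w (k + l)
  here       ++ʷ q = q
  step uw p  ++ʷ q = step uw (p ++ʷ q)

  firstStep : ∀ {u v k} → Walk G u v k → Fin n
  firstStep {v = v} here       = v
  firstStep (step {w = w} _ _) = w

  Adj-firstStep : ∀ {u v k} → u ≢ v → (p : Walk G u v k) → Adj G u (firstStep p)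
  Adj-firstStep u≢v here       = ⊥-elim (u≢v refl)
  Adj-firstStep _   (step uw _) = uw

  DistLe-refl : ∀ {u t} → DistLe G u u t
  DistLe-refl = 0 , here , z≤n

  Adj⇒DistLe : ∀ {u v t} → 1 ≤ t → Adj G u v → DistLe G u v t
  Adj⇒DistLe 1≤t uv = 1 , step uv here , 1≤t

  DistLe-sym : ∀ {u v t} → DistLe G u v t → DistLe G v u t
  DistLe-sym (k , p , k≤t) = k , Walk-reverse p , k≤t

  DistLe-trans : ∀ {u v w s t} → DistLe G u v s → DistLe G v w t → DistLe G u w (s + t)
  DistLe-trans (k , p , k≤s) (l , q , l≤t) = k + l , p ++ʷ q , +-mono-≤ k≤s l≤t

  DistLe≤1⇒Adj : ∀ {u v t} → u ≢ v → t ≤ 1 → DistLe G u v t → Adj G u v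
  DistLe≤1⇒Adj u≢v _   (zero , here , _)             = ⊥-elim (u≢v refl)
  DistLe≤1⇒Adj _   _   (suc zero , step uv here , _) = uv
  DistLe≤1⇒Adj _   t≤1 (suc (suc _) , _ , k≤t) with ≤-trans k≤t t≤1
  ... | s≤s ()

data Within2 {n} (G : Graph n) (u v : Fin n) : Set where
  edge : Adj G u v → Within2 G u v
  via  : ∀ w → Adj G u w → Adj G w v → Within2 G u v

DistLe⇒Within2 : ∀ {n} {G : Graph n} {u v} → u ≢ v → DistLe G u v 2 → Within2 G u v
DistLe⇒Within2 u≢v (zero , here , _)                           = ⊥-elim (u≢v refl)
DistLe⇒Within2 _   (suc zero , step uv here , _)               = edge uv
DistLe⇒Within2 _   (suc (suc zero) , step uw (step wv here) , _) = via _ uw wv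
DistLe⇒Within2 _   (suc (suc (suc _)) , _ , s≤s (s≤s ()))

-- Cycles

Linked-consecutive : ∀ {A : Set} {R : A → A → Set} {m} {xs : Vec A (suc m)} →
  Linked R xs → ∀ (i : Fin m) → R (lookup xs (inject₁ i)) (lookup xs (suc i))
Linked-consecutive {xs = _ ∷ _ ∷ _} (r ∷ _)  zero    = r
Linked-consecutive {xs = _ ∷ _ ∷ _} (_ ∷ rs) (suc i) = Linked-consecutive rs i

cycle : ∀ {n} {G : Graph n} {k} (vs : Vec (Fin n) (3 + k)) → Unique vs → Linked (Adj G) vs →
  Adj G (lookup vs (fromℕ (2 + k))) (lookup vs zero) → HasCycle G
cycle {k = k} vs distinct path closing =
  k , lookup vs , (λ {i} {j} → lookup-injective distinct i j) , Linked-consecutive path , closing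

module _ {n} {T : Graph n} (acyclic : ¬ HasCycle T) where

  triangle-free : ∀ {a b c} → Adj T a b → Adj T b c → Adj T c a → ⊥
  triangle-free ab bc ca = acyclic (cycle {G = T} (_ ∷ _ ∷ _ ∷ [])
    ((Adj⇒≢ T ab ∷ ≢-sym (Adj⇒≢ T ca) ∷ []) ∷ (Adj⇒≢ T bc ∷ []) ∷ [] ∷ [])
    (ab ∷ bc ∷ [-]) ca)

  square-free : ∀ {a b c d} → a ≢ c → b ≢ d →
    Adj T a b → Adj T b c → Adj T c d → Adj T d a → ⊥
  square-free a≢c b≢d ab bc cd da = acyclic (cycle {G = T} (_ ∷ _ ∷ _ ∷ _ ∷ [])
    ( (Adj⇒≢ T ab ∷ a≢c ∷ ≢-sym (Adj⇒≢ T da) ∷ [])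
    ∷ (Adj⇒≢ T bc ∷ b≢d ∷ [])
    ∷ (Adj⇒≢ T cd ∷ [])
    ∷ [] ∷ [])
    (ab ∷ bc ∷ cd ∷ [-]) da)

  pentagon-free : ∀ {a b c d e} → a ≢ c → a ≢ d → b ≢ d → b ≢ e → c ≢ e →
    Adj T a b → Adj T b c → Adj T c d → Adj T d e → Adj T e a → ⊥
  pentagon-free a≢c a≢d b≢d b≢e c≢e ab bc cd de ea = acyclic (cycle {G = T} (_ ∷ _ ∷ _ ∷ _ ∷ _ ∷ [])
    ( (Adj⇒≢ T ab ∷ a≢c ∷ a≢d ∷ ≢-sym (Adj⇒≢ T ea) ∷ [])
    ∷ (Adj⇒≢ T bc ∷ b≢d ∷ b≢e ∷ [])
    ∷ (Adj⇒≢ T cd ∷ c≢e ∷ [])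
    ∷ (Adj⇒≢ T de ∷ [])
    ∷ [] ∷ [])
    (ab ∷ bc ∷ cd ∷ de ∷ [-]) ea)

  hexagon-free : ∀ {a b c d e f} →
    a ≢ c → a ≢ d → a ≢ e → b ≢ d → b ≢ e → b ≢ f → c ≢ e → c ≢ f → d ≢ f →
    Adj T a b → Adj T b c → Adj T c d → Adj T d e → Adj T e f → Adj T f a → ⊥
  hexagon-free a≢c a≢d a≢e b≢d b≢e b≢f c≢e c≢f d≢f ab bc cd de ef fa =
    acyclic (cycle {G = T} (_ ∷ _ ∷ _ ∷ _ ∷ _ ∷ _ ∷ [])
    ( (Adj⇒≢ T ab ∷ a≢c ∷ a≢d ∷ a≢e ∷ ≢-sym (Adj⇒≢ T fa) ∷ [])
    ∷ (Adj⇒≢ T bc ∷ b≢d ∷ b≢e ∷ b≢f ∷ [])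
    ∷ (Adj⇒≢ T cd ∷ c≢e ∷ c≢f ∷ [])
    ∷ (Adj⇒≢ T de ∷ d≢f ∷ [])
    ∷ (Adj⇒≢ T ef ∷ [])
    ∷ [] ∷ [])
    (ab ∷ bc ∷ cd ∷ de ∷ ef ∷ [-]) fa)

HasCycle-mono : ∀ {n} {G H : Graph n} → Subgraph G H → HasCycle G → HasCycle H
HasCycle-mono G⊆H (k , c , injective , edges , closing) =
  k , c , injective , (λ i → G⊆H _ _ (edges i)) , G⊆H _ _ closing

2≤stretch : ∀ {n} {G : Graph n} {s} → Connected G → ¬ IsTree G → HasTreeSpanner G s → 2 ≤ s
2≤stretch {G = G} {s} connected ¬tree (T , _ , (_ , T-acyclic) , spanner) with 2 ℕ.≤? s
... | yes 2≤s = 2≤s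
... | no  2≰s = ⊥-elim (¬tree (connected , T-acyclic ∘ HasCycle-mono {G = G} {H = T} G⊆T))
  where
  G⊆T : Subgraph G T
  G⊆T u v uv = DistLe≤1⇒Adj (Adj⇒≢ G uv) (ℕ.≤-pred (≰⇒> 2≰s)) (spanner u v uv)

-- Degrees

neighbours : ∀ {n} → Graph n → Fin n → List (Fin n)
neighbours {n} G v = filterᵇ (adj G v) (allFin n)

module _ {n} (G : Graph n) {v : Fin n} where

  ∈-neighbours⁺ : ∀ {w} → Adj G v w → w ∈ neighbours G v
  ∈-neighbours⁺ {w} vw =
    ∈-filter⁺ (T? ∘ adj G v) {xs = allFin n} (∈-allFin w) (Equivalence.from T-≡ vw)

  ∈-neighbours⁻ : ∀ {w} → w ∈ neighbours G v → Adj G v w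
  ∈-neighbours⁻ w∈ = Equivalence.to T-≡ (proj₂ (∈-filter⁻ (T? ∘ adj G v) {xs = allFin n} w∈))

  neighbours-unique : List.Unique (neighbours G v)
  neighbours-unique = filter⁺ (T? ∘ adj G v) (allFin⁺ n)

2≤length⁺ : ∀ {A : Set} {xs : List A} {a b} → a ≢ b → a ∈ xs → b ∈ xs → 2 ≤ length xs
2≤length⁺ a≢b (here refl)       (here refl)       = ⊥-elim (a≢b refl)
2≤length⁺ _   (here _)          (there (here _))  = s≤s (s≤s z≤n)
2≤length⁺ _   (here _)          (there (there _)) = s≤s (s≤s z≤n)
2≤length⁺ _   (there (here _))  _                 = s≤s (s≤s z≤n)
2≤length⁺ _   (there (there _)) _                 = s≤s (s≤s z≤n)

2≤length⁻ : ∀ {A : Set} {xs : List A} → List.Unique xs → 2 ≤ length xs →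
  ∃[ a ] ∃[ b ] (a ≢ b × a ∈ xs × b ∈ xs)
2≤length⁻ {xs = a ∷ b ∷ _} ((a≢b ∷ _) ∷ _) _ = a , b , a≢b , here refl , there (here refl)
2≤length⁻ {xs = _ ∷ []}    _ (s≤s ())

module _ {n} (G : Graph n) {v : Fin n} where

  2≤degree⁺ : ∀ {a b} → a ≢ b → Adj G v a → Adj G v b → 2 ≤ degree G v
  2≤degree⁺ a≢b va vb = 2≤length⁺ a≢b (∈-neighbours⁺ G va) (∈-neighbours⁺ G vb)

  2≤degree⁻ : 2 ≤ degree G v → ∃[ a ] ∃[ b ] (a ≢ b × Adj G v a × Adj G v b)
  2≤degree⁻ 2≤d with 2≤length⁻ (neighbours-unique G) 2≤d
  ... | a , b , a≢b , a∈ , b∈ = a , b , a≢b , ∈-neighbours⁻ G a∈ , ∈-neighbours⁻ G b∈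

-- Trees given by parent pointers

argmax : ∀ {m} (f : Fin (suc m) → ℕ) → ∃[ i ] (∀ j → f j ≤ f i)
argmax {zero}  f = zero , λ { zero → ≤-refl }
argmax {suc m} f with argmax (f ∘ suc)
... | i , max with f zero ℕ.≤? f (suc i)
...   | yes f0≤ = suc i , λ { zero → f0≤ ; (suc j) → max j }
...   | no  f0≰ = zero  , λ { zero → ≤-refl ; (suc j) → ≤-trans (max j) (<⇒≤ (≰⇒> f0≰)) }

fromℕ-or-inject₁ : ∀ {m} (i : Fin (suc m)) → i ≡ fromℕ m ⊎ ∃[ j ] i ≡ inject₁ j
fromℕ-or-inject₁ {zero}  zero    = inj₁ refl
fromℕ-or-inject₁ {suc m} zero    = inj₂ (zero , refl)
fromℕ-or-inject₁ {suc m} (suc i) with fromℕ-or-inject₁ i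
... | inj₁ refl       = inj₁ refl
... | inj₂ (j , refl) = inj₂ (suc j , refl)

inject₁²≢suc² : ∀ {m} (i : Fin m) → inject₁ (inject₁ i) ≢ suc (suc i)
inject₁²≢suc² zero    ()
inject₁²≢suc² (suc i) eq = inject₁²≢suc² i (suc-injective eq)

cycle-neighbours : ∀ {n} {G : Graph n} {k} (c : Fin (3 + k) → Fin n) →
  (∀ (i : Fin (2 + k)) → Adj G (c (inject₁ i)) (c (suc i))) → Adj G (c (fromℕ (2 + k))) (c zero) →
  ∀ i → ∃[ a ] ∃[ b ] (a ≢ b × Adj G (c i) (c a) × Adj G (c i) (c b))
cycle-neighbours {G = G} {k} c edges closing zero =
  fromℕ (2 + k) , suc zero , (λ ()) , Adj-sym G closing , edges zero
cycle-neighbours {G = G} {k} c edges closing (suc i) with fromℕ-or-inject₁ i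
... | inj₁ refl =
  inject₁ (fromℕ (1 + k)) , zero , (λ ()) , Adj-sym G (edges (fromℕ (1 + k))) , closing
... | inj₂ (j , refl) =
  inject₁ (inject₁ j) , suc (suc j) , inject₁²≢suc² j ,
  Adj-sym G (edges (inject₁ j)) , edges (suc j)

does⇒ : ∀ {A : Set} (a? : Dec A) → does a? ≡ true → A
does⇒ (yes a) _ = a

module ParentTree {n} (root : Fin n) (parent : Fin n → Fin n) (rank : Fin n → ℕ)
                  (rank-parent< : ∀ {v} → v ≢ root → rank (parent v) < rank v) where

  ChildOf : Fin n → Fin n → Set
  ChildOf u v = u ≢ root × parent u ≡ v

  childOf? : ∀ u v → Dec (ChildOf u v)
  childOf? u v = ¬? (u ≟ root) ×-dec (parent u ≟ v)

  ¬ChildOf-self : ∀ {v} → ¬ ChildOf v v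
  ¬ChildOf-self (v≢root , pv≡v) = <-irrefl (cong rank pv≡v) (rank-parent< v≢root)

  tree : Graph n
  tree = record
    { adj    = λ u v → does (childOf? u v ⊎-dec childOf? v u)
    ; sym    = λ u v → ∨-comm (does (childOf? u v)) (does (childOf? v u))
    ; irrefl = λ v → dec-false (childOf? v v ⊎-dec childOf? v v) [ ¬ChildOf-self , ¬ChildOf-self ]
    }

  Adj-tree⇒ : ∀ {u v} → Adj tree u v → ChildOf u v ⊎ ChildOf v u
  Adj-tree⇒ {u} {v} = does⇒ (childOf? u v ⊎-dec childOf? v u)

  Adj-parent : ∀ {v} → v ≢ root → Adj tree v (parent v)
  Adj-parent {v} v≢root =
    dec-true (childOf? v (parent v) ⊎-dec childOf? (parent v) v) (inj₁ (v≢root , refl))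

  walk-to-root : ∀ fuel v → rank v < fuel → ∃[ k ] Walk tree v root k
  walk-to-root (suc fuel) v (s≤s rank≤fuel) with v ≟ root
  ... | yes refl   = 0 , here
  ... | no v≢root with walk-to-root fuel (parent v) (≤-trans (rank-parent< v≢root) rank≤fuel)
  ...   | k , p = suc k , step (Adj-parent v≢root) p

  connected : Connected tree
  connected u v with walk-to-root _ u ≤-refl | walk-to-root _ v ≤-refl
  ... | k , p | l , q = k + l , p ++ʷ Walk-reverse q

  -- A vertex of maximal rank on a cycle would have both of its cycle-neighbours as parent.
  acyclic : ¬ HasCycle tree
  acyclic (k , c , injective , edges , closing) with argmax (rank ∘ c)
  ... | i , maximal with cycle-neighbours {G = tree} c edges closing i
  ...   | a , b , a≢b , ia , ib = a≢b (injective (trans (≡.sym (parent-is ia)) (parent-is ib)))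
    where
    parent-is : ∀ {j} → Adj tree (c i) (c j) → parent (c i) ≡ c j
    parent-is {j} e with Adj-tree⇒ e
    ... | inj₁ (_ , p≡) = p≡
    ... | inj₂ (cj≢root , p≡) =
      ⊥-elim (<⇒≱ (subst (λ w → rank w < rank (c j)) p≡ (rank-parent< cj≢root)) (maximal j))

  isTree : IsTree tree
  isTree = connected , acyclic

-- Stars in acyclic graphs

Centre : ∀ {n} → Graph n → (Fin n → Set) → Fin n → Set
Centre T P c = ∀ {v} → P v → v ≡ c ⊎ Adj T v c

module _ {n} {T : Graph n} (acyclic : ¬ HasCycle T) where

  private
    pentagon-through : ∀ {x₁ x₂ m x₃ w} → x₁ ≢ x₂ → ¬ Adj T x₁ x₂ → x₃ ≢ m → ¬ Adj T x₃ m →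
      Adj T x₁ m → Adj T m x₂ → Adj T x₃ x₁ → Adj T x₃ w → Adj T w x₂ → ⊥
    pentagon-through x₁≢x₂ x₁≁x₂ x₃≢m x₃≁m x₁m mx₂ x₃x₁ x₃w wx₂ =
      pentagon-free {T = T} acyclic
        x₁≢x₂ (λ { refl → x₁≁x₂ wx₂ }) (λ { refl → x₃≁m x₃w }) (≢-sym x₃≢m)
        (λ { refl → x₃≁m (Adj-sym T mx₂) })
        x₁m mx₂ (Adj-sym T wx₂) (Adj-sym T x₃w) x₃x₁

  -- The T-paths of length ≤ 2 from x₃ to x₁ and x₂ close a cycle of length 4, 5 or 6
  -- with x₁ – m – x₂.
  far-from-middle : ∀ {x₁ x₂ m x₃} → x₁ ≢ x₂ → ¬ Adj T x₁ x₂ → Adj T x₁ m → Adj T m x₂ →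
    x₃ ≢ m → ¬ Adj T x₃ m → Within2 T x₃ x₁ → Within2 T x₃ x₂ → ⊥
  far-from-middle x₁≢x₂ x₁≁x₂ x₁m mx₂ x₃≢m x₃≁m (edge x₃x₁) (edge x₃x₂) =
    square-free {T = T} acyclic x₁≢x₂ (≢-sym x₃≢m) x₁m mx₂ (Adj-sym T x₃x₂) x₃x₁
  far-from-middle x₁≢x₂ x₁≁x₂ x₁m mx₂ x₃≢m x₃≁m (edge x₃x₁) (via w x₃w wx₂) =
    pentagon-through x₁≢x₂ x₁≁x₂ x₃≢m x₃≁m x₁m mx₂ x₃x₁ x₃w wx₂
  far-from-middle x₁≢x₂ x₁≁x₂ x₁m mx₂ x₃≢m x₃≁m (via w x₃w wx₁) (edge x₃x₂) =
    pentagon-through (≢-sym x₁≢x₂) (x₁≁x₂ ∘ Adj-sym T) x₃≢m x₃≁m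
      (Adj-sym T mx₂) (Adj-sym T x₁m) x₃x₂ x₃w wx₁
  far-from-middle x₁≢x₂ x₁≁x₂ x₁m mx₂ x₃≢m x₃≁m (via w x₃w wx₁) (via w′ x₃w′ w′x₂) with w ≟ w′
  ... | yes refl =
    square-free {T = T} acyclic (λ { refl → x₃≁m x₃w }) x₁≢x₂ wx₁ x₁m mx₂ (Adj-sym T w′x₂)
  ... | no w≢w′ =
    hexagon-free {T = T} acyclic (λ { refl → x₃≁m x₁m }) x₃≢m (λ { refl → x₃≁m (Adj-sym T mx₂) })
      (λ { refl → x₃≁m x₃w }) (λ { refl → x₁≁x₂ (Adj-sym T wx₁) }) w≢w′
      x₁≢x₂ (λ { refl → x₁≁x₂ w′x₂ }) (λ { refl → x₃≁m x₃w′ })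
      x₃w wx₁ x₁m mx₂ (Adj-sym T w′x₂) (Adj-sym T x₃w′)

  module _ {P : Fin n → Set} (P? : Decidable P)
           (close : ∀ {u v} → P u → P v → u ≢ v → Within2 T u v) where

    middle-is-centre : ∀ {x₁ x₂ m} → P x₁ → P x₂ → x₁ ≢ x₂ → ¬ Adj T x₁ x₂ →
      Adj T x₁ m → Adj T m x₂ → Centre T P m
    middle-is-centre {m = m} p₁ p₂ x₁≢x₂ x₁≁x₂ x₁m mx₂ {x₃} p₃ with x₃ ≟ m | Adj? T x₃ m
    ... | yes x₃≡m | _       = inj₁ x₃≡m
    ... | no _     | yes x₃m = inj₂ x₃m
    ... | no x₃≢m  | no x₃≁m = ⊥-elim (far-from-middle x₁≢x₂ x₁≁x₂ x₁m mx₂ x₃≢m x₃≁m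
      (close p₃ p₁ λ { refl → x₃≁m x₁m }) (close p₃ p₂ λ { refl → x₃≁m (Adj-sym T mx₂) }))

    close⇒centre : ∃ P → ∃ (Centre T P)
    close⇒centre (x₁ , p₁) with any? (λ v → P? v ×-dec ¬? (v ≟ x₁ ⊎-dec Adj? T v x₁))
    ... | no none = x₁ , λ {v} p →
      decidable-stable (v ≟ x₁ ⊎-dec Adj? T v x₁) (λ ¬star → none (v , p , ¬star))
    ... | yes (x₂ , p₂ , ¬star) with close p₁ p₂ (λ { refl → ¬star (inj₁ refl) })
    ...   | edge x₁x₂     = ⊥-elim (¬star (inj₂ (Adj-sym T x₁x₂)))
    ...   | via m x₁m mx₂ =
      m , middle-is-centre p₁ p₂ (λ { refl → ¬star (inj₁ refl) }) (¬star ∘ inj₂ ∘ Adj-sym T) x₁m mx₂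

-- Split graphs

Hub : ∀ {n} → Graph n → (Fin n → Bool) → Fin n → Set
Hub G inX x = ∀ y → inX y ≡ false → 2 ≤ degree G y → Adj G x y

leaves⇒Hub : ∀ {n} {G : Graph n} {inX x} → (∀ y → inX y ≡ false → degree G y ≡ 1) → Hub G inX x
leaves⇒Hub leaves y y∈Y 2≤d with subst (2 ≤_) (leaves y y∈Y) 2≤d
... | s≤s ()

module SplitGraph {n} (G : Graph n) (inX : Fin n → Bool) (split : IsSplitPartition G inX) where

  clique : ∀ {u v} → inX u ≡ true → inX v ≡ true → u ≢ v → Adj G u v
  clique = proj₁ split _ _

  independent : ∀ {u v} → inX u ≡ false → inX v ≡ false → ¬ Adj G u v
  independent = proj₂ split _ _

  X≢Y : ∀ {u v} → inX u ≡ true → inX v ≡ false → u ≢ v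
  X≢Y u∈X v∈Y refl with () ← trans (≡.sym u∈X) v∈Y

  Y-neighbour∈X : ∀ {y w} → inX y ≡ false → Adj G y w → inX w ≡ true
  Y-neighbour∈X {w = w} y∈Y yw =
    decidable-stable (inX w Bool.≟ true) (λ w∉X → independent y∈Y (¬-not w∉X) yw)

  X-nonempty : Connected G → ¬ IsTree G → ∃[ x ] inX x ≡ true
  X-nonempty connected ¬tree with any? (λ v → inX v Bool.≟ true)
  ... | yes x∈X = x∈X
  ... | no  ¬X  = ⊥-elim (¬tree (connected , λ (_ , _ , _ , _ , closing) →
                    independent (∈Y _) (∈Y _) closing))
    where
    ∈Y : ∀ v → inX v ≡ false
    ∈Y v = ¬-not (λ v∈X → ¬X (v , v∈X))

module Sufficiency {n} (G : Graph n) (inX : Fin n → Bool) (split : IsSplitPartition G inX)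
                   (connected : Connected G)
                   {x : Fin n} (x∈X : inX x ≡ true) (hub : Hub G inX x) where

  open SplitGraph G inX split

  Near : Fin n → Set
  Near v = inX v ≡ true ⊎ Adj G x v

  near? : ∀ v → Dec (Near v)
  near? v = (inX v Bool.≟ true) ⊎-dec Adj? G x v

  far⇒∈Y : ∀ {v} → ¬ Near v → inX v ≡ false
  far⇒∈Y ¬near = ¬-not (¬near ∘ inj₁)

  far⇒≢x : ∀ {v} → ¬ Near v → v ≢ x
  far⇒≢x ¬near refl = ¬near (inj₁ x∈X)

  towards : Fin n → Fin n
  towards v = firstStep (proj₂ (connected v x))

  towards-adjacent : ∀ {v} → v ≢ x → Adj G v (towards v)
  towards-adjacent v≢x = Adj-firstStep v≢x (proj₂ (connected _ x))

  -- A vertex that is not near lies in Y, is not adjacent to the hub x, hence has degree 1,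
  -- and hangs from its unique neighbour.
  parent : Fin n → Fin n
  parent v with near? v
  ... | yes _ = x
  ... | no  _ = towards v

  rank : Fin n → ℕ
  rank v with v ≟ x | near? v
  ... | yes _ | _     = 0
  ... | no  _ | yes _ = 1
  ... | no  _ | no  _ = 2

  parent-near : ∀ {v} → Near v → parent v ≡ x
  parent-near {v} near with near? v
  ... | yes _    = refl
  ... | no ¬near = ⊥-elim (¬near near)

  parent-far : ∀ {v} → ¬ Near v → parent v ≡ towards v
  parent-far {v} ¬near with near? v
  ... | yes near = ⊥-elim (¬near near)
  ... | no _     = refl

  rank-root : rank x ≡ 0
  rank-root with x ≟ x
  ... | yes _   = refl
  ... | no x≢x = ⊥-elim (x≢x refl)

  rank-nonroot : ∀ {v} → v ≢ x → 1 ≤ rank v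
  rank-nonroot {v} v≢x with v ≟ x | near? v
  ... | yes v≡x | _     = ⊥-elim (v≢x v≡x)
  ... | no _    | yes _ = s≤s z≤n
  ... | no _    | no _  = s≤s z≤n

  rank-near : ∀ {v} → Near v → rank v ≤ 1
  rank-near {v} near with v ≟ x | near? v
  ... | yes _ | _        = z≤n
  ... | no _  | yes _    = s≤s z≤n
  ... | no _  | no ¬near = ⊥-elim (¬near near)

  rank-far : ∀ {v} → ¬ Near v → rank v ≡ 2
  rank-far {v} ¬near with v ≟ x | near? v
  ... | yes v≡x | _        = ⊥-elim (far⇒≢x ¬near v≡x)
  ... | no _    | yes near = ⊥-elim (¬near near)
  ... | no _    | no _     = refl

  rank-parent< : ∀ {v} → v ≢ x → rank (parent v) < rank v
  rank-parent< {v} v≢x = [ near-case , far-case ]′ (toSum (near? v))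
    where
    open ℕ.≤-Reasoning
    near-case : Near v → rank (parent v) < rank v
    near-case near = begin-strict
      rank (parent v) ≡⟨ cong rank (parent-near near) ⟩
      rank x          ≡⟨ rank-root ⟩
      0               <⟨ rank-nonroot v≢x ⟩
      rank v          ∎
    far-case : ¬ Near v → rank (parent v) < rank v
    far-case ¬near = begin-strict
      rank (parent v)  ≡⟨ cong rank (parent-far ¬near) ⟩
      rank (towards v) <⟨ s≤s (rank-near (inj₁ towards-v∈X)) ⟩
      2                ≡⟨ ≡.sym (rank-far ¬near) ⟩
      rank v           ∎
      where
      towards-v∈X : inX (towards v) ≡ true
      towards-v∈X = Y-neighbour∈X (far⇒∈Y ¬near) (towards-adjacent v≢x)

  open ParentTree x parent rank rank-parent<

  parent-adjacent : ∀ {v} → v ≢ x → Adj G v (parent v)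
  parent-adjacent {v} v≢x with near? v
  ... | yes (inj₁ v∈X) = clique v∈X x∈X v≢x
  ... | yes (inj₂ xv)  = Adj-sym G xv
  ... | no _           = towards-adjacent v≢x

  tree⊆G : Subgraph tree G
  tree⊆G u v uv with Adj-tree⇒ uv
  ... | inj₁ (u≢x , pu≡v) = subst (Adj G u) pu≡v (parent-adjacent u≢x)
  ... | inj₂ (v≢x , pv≡u) = Adj-sym G (subst (Adj G v) pv≡u (parent-adjacent v≢x))

  near⇒close-to-root : ∀ {v} → Near v → DistLe tree v x 1
  near⇒close-to-root {v} near with v ≟ x
  ... | yes refl = DistLe-refl
  ... | no v≢x   = Adj⇒DistLe ≤-refl (subst (Adj tree v) (parent-near near) (Adj-parent v≢x))

  far-edge : ∀ {u v} → ¬ Near v → Adj G u v → Adj tree v u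
  far-edge {u} {v} ¬near uv =
    subst (Adj tree v) (trans (parent-far ¬near) towards≡u) (Adj-parent (far⇒≢x ¬near))
    where
    towards≡u : towards v ≡ u
    towards≡u with towards v ≟ u
    ... | yes eq = eq
    ... | no t≢u = ⊥-elim (¬near (inj₂ (hub v (far⇒∈Y ¬near)
                     (2≤degree⁺ G t≢u (towards-adjacent (far⇒≢x ¬near)) (Adj-sym G uv)))))

  stretch-2 : ∀ u v → Adj G u v → DistLe tree u v 2
  stretch-2 u v uv with near? u | near? v
  ... | yes nu | yes nv = DistLe-trans (near⇒close-to-root nu) (DistLe-sym (near⇒close-to-root nv))
  ... | _      | no ¬nv = DistLe-sym (Adj⇒DistLe (s≤s z≤n) (far-edge ¬nv uv))
  ... | no ¬nu | _      = Adj⇒DistLe (s≤s z≤n) (far-edge ¬nu (Adj-sym G uv))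

  tree-2-spanner : HasTreeSpanner G 2
  tree-2-spanner = tree , tree⊆G , isTree , stretch-2

module Necessity {n} (G : Graph n) (inX : Fin n → Bool) (split : IsSplitPartition G inX)
                 (T : Graph n) (T⊆G : Subgraph T G) (T-acyclic : ¬ HasCycle T)
                 (spanner : ∀ u v → Adj G u v → DistLe T u v 2) where

  open SplitGraph G inX split

  InX : Fin n → Set
  InX v = inX v ≡ true

  edge-within2 : ∀ {u v} → Adj G u v → Within2 T u v
  edge-within2 {u} {v} uv = DistLe⇒Within2 (Adj⇒≢ G uv) (spanner u v uv)

  X-centre : ∃ InX → ∃ (Centre T InX)
  X-centre = close⇒centre T-acyclic (λ v → inX v Bool.≟ true)
    (λ u∈X v∈X u≢v → edge-within2 (clique u∈X v∈X u≢v))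

  module _ {c : Fin n} (centre : Centre T InX c)
           {y : Fin n} (y∈Y : inX y ≡ false) (y≁c : ¬ Adj G y c) where

    Y-neighbour→centre : ∀ {a} → Adj G y a → Adj T a c
    Y-neighbour→centre ya with centre (Y-neighbour∈X y∈Y ya)
    ... | inj₁ refl = ⊥-elim (y≁c ya)
    ... | inj₂ ac   = ac

    Y-edge∈T : ∀ {a} → Adj G y a → Adj T y a
    Y-edge∈T ya with edge-within2 ya
    ... | edge t      = t
    ... | via _ yw wa = ⊥-elim (triangle-free {T = T} T-acyclic wa (Y-neighbour→centre ya)
                           (Adj-sym T (Y-neighbour→centre (T⊆G _ _ yw))))

  centre-adjacent : ∀ {c} → Centre T InX c → ∀ {y} → inX y ≡ false → y ≢ c →
    2 ≤ degree G y → Adj G y c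
  centre-adjacent {c} centre {y} y∈Y y≢c 2≤d with Adj? G y c
  ... | yes yc  = yc
  ... | no  y≁c with 2≤degree⁻ G 2≤d
  ...   | a , b , a≢b , ya , yb = ⊥-elim (square-free {T = T} T-acyclic y≢c a≢b
            (Y-edge∈T centre y∈Y y≁c ya) (Y-neighbour→centre centre y∈Y y≁c ya)
            (Adj-sym T (Y-neighbour→centre centre y∈Y y≁c yb))
            (Adj-sym T (Y-edge∈T centre y∈Y y≁c yb)))

  hub-exists : ∃ InX → ∃[ x ] (inX x ≡ true × Hub G inX x)
  hub-exists (x₁ , x₁∈X) with X-centre (x₁ , x₁∈X)
  ... | c , centre with inX c in c∈?
  ...   | true  = c , c∈? , λ y y∈Y 2≤d →
    Adj-sym G (centre-adjacent centre y∈Y (≢-sym (X≢Y c∈? y∈Y)) 2≤d)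
  ...   | false with centre x₁∈X   -- by independence, no y ∈ Y other than c is adjacent to c
  ...     | inj₁ x₁≡c = ⊥-elim (X≢Y x₁∈X c∈? x₁≡c)
  ...     | inj₂ x₁c  = x₁ , x₁∈X , x₁-hub
    where
    x₁-hub : Hub G inX x₁
    x₁-hub y y∈Y 2≤d with y ≟ c
    ... | yes refl = T⊆G _ _ x₁c
    ... | no  y≢c  = ⊥-elim (independent y∈Y c∈? (centre-adjacent centre y∈Y y≢c 2≤d))

proposition1 : ∀ {n} (G : Graph n) (inX : Fin n → Bool)
    → IsSplitPartition G inX
    → Connected G
    → ¬ IsTree G
    → StretchIndex G 2
      ⇔ ((∀ y → inX y ≡ false → degree G y ≡ 1)
         ⊎ (∃[ x ] (inX x ≡ true
              × (∀ y → inX y ≡ false → 2 ≤ degree G y → Adj G x y))))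
proposition1 G inX split connected ¬tree = mk⇔ necessary sufficient
  where
  open SplitGraph G inX split

  Condition : Set
  Condition = (∀ y → inX y ≡ false → degree G y ≡ 1) ⊎ ∃[ x ] (inX x ≡ true × Hub G inX x)

  necessary : StretchIndex G 2 → Condition
  necessary ((T , T⊆G , (_ , T-acyclic) , spanner) , _) =
    inj₂ (Necessity.hub-exists G inX split T T⊆G T-acyclic spanner (X-nonempty connected ¬tree))

  stretch-index-2 : ∀ {x} → inX x ≡ true → Hub G inX x → StretchIndex G 2
  stretch-index-2 x∈X hub =
    Sufficiency.tree-2-spanner G inX split connected x∈X hub , λ _ → 2≤stretch connected ¬tree

  sufficient : Condition → StretchIndex G 2
  sufficient (inj₁ leaves)          =
    stretch-index-2 (proj₂ (X-nonempty connected ¬tree)) (leaves⇒Hub {G = G} {inX} leaves)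
  sufficient (inj₂ (_ , x∈X , hub)) = stretch-index-2 x∈X hub
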